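{- Every face of $\mathbb{F}$ that contains $\eta_H$ for every full graph $H$ over $N$ is an SE face of $\mathbb{F}$.
   Context: Let $N$ be a finite set with $n=|N|\ge 2$, and let $\mathrm{DAG}(N)$ be the set of acyclic directed graphs with node set $N$; $\mathrm{pa}_G(a)$ denotes the set of parents of $a$ in $G$. A full graph is a $G\in\mathrm{DAG}(N)$ in which every two distinct nodes are adjacent. $G\sim H$ denotes Markov equivalence (same adjacencies and same immoralities). Let $\Upsilon=\{(a|B): a\in N,\ \emptyset\neq B\subseteq N\setminus\{a\}\}$; for $G\in\mathrm{DAG}(N)$, $\eta_G\in\mathbb{R}^{\Upsilon}$ is given by $\eta_G(a|B)=1$ if $B=\mathrm{pa}_G(a)$ and $0$ otherwise; $\mathbb{F}=\mathrm{conv}\{\eta_G:G\in\mathrm{DAG}(N)\}$ is the family-variable polytope; $\langle\mathbf{o},\eta\rangle=\sum_{(a|B)\in\Upsilon}\mathbf{o}(a|B)\eta(a|B)$. A face of $\mathbb{F}$ is a set $\{\eta\in\mathbb{F}:\langle\mathbf{o},\eta\rangle=u\}$ for some $\mathbf{o}\in\mathbb{R}^{\Upsilon}$, $u\in\mathbb{R}$ with $\langle\mathbf{o},\eta\rangle\le u$ valid on $\mathbb{F}$. An SE objective is $\mathbf{o}\in\mathbb{R}^{\Upsilon}$ with $\langle\mathbf{o},\eta_G\rangle=\langle\mathbf{o},\eta_H\rangle$ whenever $G\sim H$. A face of $\mathbb{F}$ is an SE face if it can be defined in this way by some valid inequality $\langle\mathbf{o},\eta\rangle\le u$ whose objective $\mathbf{o}$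 is SE.
   Formalization: Points have rational coordinates, and the objectives $\mathbf{o}$ and thresholds $u$ are rational rather than real, so 𝔽 and its faces consist of rational points. -}

module Defs where

open import Level using (0ℓ)
open import Data.Nat using (ℕ; zero; suc)
open import Data.Bool using (Bool; true; false)
open import Data.Fin using (Fin; _≟_)
open import Data.Fin.Subset using (Subset; _∈_; _∉_; Nonempty; inside; outside)
open import Data.Fin.Subset.Properties using (_∈?_; nonempty?)
open import Data.Vec using (Vec; []; _∷_)
open import Data.List using (List; []; _∷_; map; concatMap; _++_)
open import Data.List.Relation.Unary.All using (All)
open import Data.Product using (Σ; ∃; ∃-syntax; _×_; _,_; proj₁; proj₂)
open import Data.Sum using (_⊎_)
open import Data.Rational using (ℚ; 0ℚ; 1ℚ; _+_; _*_; _≤_)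
open import Relation.Nullary using (¬_; yes; no; Dec)
open import Relation.Nullary.Decidable using (_×-dec_; ¬?)
open import Relation.Binary.PropositionalEquality using (_≡_; _≢_)
open import Relation.Binary.Construct.Closure.Transitive using (TransClosure)
open import Relation.Unary using (Pred)
open import Function.Bundles using (_⇔_)
import Data.Vec.Properties as VecP
import Data.Bool as B

-- Node set N = Fin n.  A directed graph is given by its parent sets.

Arrow : ∀ {n} → (Fin n → Subset n) → Fin n → Fin n → Set
Arrow pa b a = b ∈ pa a

record DAG (n : ℕ) : Set where
  field
    pa      : Fin n → Subset n
    acyclic : ∀ a → ¬ TransClosure (Arrow pa) a a
open DAG public

Adjacent : ∀ {n} → DAG n → Fin n → Fin n → Set
Adjacent G a b = (a ∈ pa G b) ⊎ (b ∈ pa G a)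

Immorality : ∀ {n} → DAG n → Fin n → Fin n → Fin n → Set
Immorality G a b c = (a ∈ pa G c) × (b ∈ pa G c) × (a ≢ b) × ¬ Adjacent G a b

_∼_ : ∀ {n} → DAG n → DAG n → Set
G ∼ H = (∀ a b → Adjacent G a b ⇔ Adjacent H a b)
      × (∀ a b c → Immorality G a b c ⇔ Immorality H a b c)

Full : ∀ {n} → DAG n → Set
Full {n} G = ∀ (a b : Fin n) → a ≢ b → Adjacent G a b

InΥ : ∀ {n} → Fin n → Subset n → Set
InΥ a B = Nonempty B × a ∉ B

inΥ? : ∀ {n} (a : Fin n) (B : Subset n) → Dec (InΥ a B)
inΥ? a B = nonempty? B ×-dec ¬? (a ∈? B)

allSubsets : (n : ℕ) → List (Subset n)
allSubsets zero = [] ∷ []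
allSubsets (suc n) = map (inside ∷_) (allSubsets n) ++ map (outside ∷_) (allSubsets n)

allFinL : (n : ℕ) → List (Fin n)
allFinL n = Data.List.allFin n

-- Points of ℚ^Υ: only coordinates (a|B) with InΥ a B are meaningful.
Point : ℕ → Set
Point n = Fin n → Subset n → ℚ

sumℚ : List ℚ → ℚ
sumℚ [] = 0ℚ
sumℚ (x ∷ xs) = x + sumℚ xs

⟨_,_⟩ : ∀ {n} → Point n → Point n → ℚ
⟨_,_⟩ {n} o η = sumℚ (concatMap (λ a → map (λ B → term a B) (allSubsets n)) (allFinL n))
  where
  term : Fin n → Subset n → ℚ
  term a B with inΥ? a B
  ... | yes _ = o a B * η a B
  ... | no  _ = 0ℚ

η : ∀ {n} → DAG n → Point n
η G a B with VecP.≡-dec B._≟_ B (pa G a)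
... | yes _ = 1ℚ
... | no  _ = 0ℚ

-- membership in 𝔽 = conv{η_G : G ∈ DAG(N)} (rational convex combinations)
InF : ∀ {n} → Point n → Set
InF {n} x = Σ (List (ℚ × DAG n)) λ ws →
    All (λ wG → 0ℚ ≤ proj₁ wG) ws
  × sumℚ (map proj₁ ws) ≡ 1ℚ
  × (∀ a B → InΥ a B → x a B ≡ sumℚ (map (λ wG → proj₁ wG * η (proj₂ wG) a B) ws))

Valid : ∀ {n} → Point n → ℚ → Set
Valid o u = ∀ x → InF x → ⟨ o , x ⟩ ≤ u

FaceOf : ∀ {n} → Point n → ℚ → Pred (Point n) 0ℓ
FaceOf o u x = InF x × ⟨ o , x ⟩ ≡ u

Defines : ∀ {n} → Pred (Point n) 0ℓ → Point n → ℚ → Set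
Defines S o u = ∀ x → S x ⇔ FaceOf o u x

IsFace : ∀ {n} → Pred (Point n) 0ℓ → Set
IsFace {n} S = Σ (Point n) λ o → Σ ℚ λ u → Valid o u × Defines S o u

SE : ∀ {n} → Point n → Set
SE {n} o = ∀ (G H : DAG n) → G ∼ H → ⟨ o , η G ⟩ ≡ ⟨ o , η H ⟩

IsSEFace : ∀ {n} → Pred (Point n) 0ℓ → Set
IsSEFace {n} S = Σ (Point n) λ o → Σ ℚ λ u → SE o × Valid o u × Defines S o u

-- Write w(a|B) for the objective o on Υ (and 0 off Υ), so that ⟨o, η_G⟩ = Σ_a w(a | pa_G a).
-- Let φ(D) be the part of the score of the full DAG listing D first that is collected on D.
-- If all full DAGs score u, comparing that DAG for D = {a} ∪ B with the full DAG listing B,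
-- then a, then the rest (the two agree outside D) gives φ({a} ∪ B) = φ(B) + w(a|B) for a ∉ B.
-- The Möbius inverse m of φ then writes w(a|B) = Σ {m(T) : a ∈ T ⊆ {a} ∪ B}, and hence
-- ⟨o, η_G⟩ = Σ_T m(T) c_G(T) for the characteristic imset c_G: c_G(T) = 1 iff T ⊆ {a} ∪ pa_G(a)
-- for some a ∈ T. If G ∼ H, such a T lies in the family of its sink in H (otherwise G would
-- have an immorality that H lacks), so c_G = c_H and o itself is an SE objective.

module Submission where

open import Defs
open import Level using (0ℓ)
open import Data.Nat using (ℕ; _≤_)
open import Relation.Unary using (Pred)

open import Algebra.Bundles using (CommutativeRing; CommutativeMonoid)
open import Data.Bool as Bool using (Bool; true; false; if_then_else_; _∨_; _∧_)
open import Data.Fin as Fin using (Fin; zero; suc; punchIn; _≟_)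
import Data.Fin.Properties as Fin
open import Data.Fin.Induction using (spo-wellFounded)
open import Data.Fin.Subset using (Subset; _∈_; _∉_; _⊆_; inside; outside; ⁅_⁆; _∪_)
open import Data.Fin.Subset.Properties using (_∈?_; _⊆?_; x∈⁅x⁆; x∈⁅y⁆⇒x≡y; x∈p∪q⁺; x∈p∪q⁻)
open import Data.List as List using (List; []; _∷_; map; concatMap; _++_)
open import Data.List.Properties using (map-cong; concatMap-cong; map-++; map-∘; map-tabulate)
open import Data.Nat as ℕ using (zero; suc; _<ᵇ_; _≡ᵇ_)
import Data.Nat.Properties as ℕ
open import Data.Product using (∃; _×_; _,_; proj₁; proj₂)
open import Data.Product.Relation.Binary.Lex.Strict using (×-Lex; ×-decidable; ×-isStrictTotalOrder)
open import Data.Product.Relation.Binary.Pointwise.NonDependent using (Pointwise)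
open import Data.Rational using (ℚ; 0ℚ; 1ℚ; _+_; _*_; _-_)
open import Data.Rational.Properties
  using (+-identityˡ; +-identityʳ; +-comm; +-assoc; *-identityˡ; *-identityʳ; *-zeroˡ; *-zeroʳ; *-distribʳ-+;
         +-*-commutativeRing; +-0-group; +-0-commutativeMonoid)
open import Data.Sum using (_⊎_; inj₁; inj₂; map₁)
open import Data.Vec using ([]; _∷_; tabulate)
open import Data.Vec.Properties using (≡-dec; tabulate-cong; lookup∘tabulate; []=⇒lookup; lookup⇒[]=; ∷-injectiveʳ)
open import Function using (_∘_; flip; id)
open import Function.Bundles using (_⇔_; mk⇔; Equivalence)
import Function.Properties.Equivalence as ⇔
open import Induction.WellFounded using (WellFounded; Acc; acc)
open import Relation.Binary using (IsStrictPartialOrder; IsStrictTotalOrder; tri<; tri≈; tri>)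
open import Relation.Binary.Construct.Closure.Transitive using (TransClosure; [_]; _∷_; transitive)
import Relation.Binary.Construct.Flip.EqAndOrd as Flip
open import Relation.Binary.PropositionalEquality
open import Relation.Nullary using (¬_; Dec; yes; no; does; contradiction)
open import Relation.Nullary.Decidable using (dec-true; dec-false; does-⇔; ¬?; _×-dec_; _⊎-dec_)

open import Algebra.Properties.Semiring.Sum (CommutativeRing.semiring +-*-commutativeRing)
  using (sum; sum-syntax; sum-cong-≗; ∑-distrib-+; sum-remove; sum-replicate-zero; *-distribʳ-sum)
open import Algebra.Properties.CommutativeSemigroup (CommutativeMonoid.commutativeSemigroup +-0-commutativeMonoid)
  using (interchange)
open import Algebra.Properties.Group +-0-group using (∙-cancelʳ; //-rightDividesˡ)
open ≡-Reasoning

private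
  variable
    n : ℕ
    P Q : Set

⟦_⟧ : Dec P → ℚ
⟦ P? ⟧ = if does P? then 1ℚ else 0ℚ

⟦⟧-yes : (P? : Dec P) → P → ⟦ P? ⟧ ≡ 1ℚ
⟦⟧-yes P? p = cong (if_then 1ℚ else 0ℚ) (dec-true P? p)

⟦⟧-no : (P? : Dec P) → ¬ P → ⟦ P? ⟧ ≡ 0ℚ
⟦⟧-no P? ¬p = cong (if_then 1ℚ else 0ℚ) (dec-false P? ¬p)

⟦⟧-⇔ : P ⇔ Q → (P? : Dec P) (Q? : Dec Q) → ⟦ P? ⟧ ≡ ⟦ Q? ⟧
⟦⟧-⇔ P⇔Q P? Q? = cong (if_then 1ℚ else 0ℚ) (does-⇔ P⇔Q P? Q?)

⟦⟧-*-cong : ∀ (P? : Dec P) {u v} → (P → u ≡ v) → ⟦ P? ⟧ * u ≡ ⟦ P? ⟧ * v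
⟦⟧-*-cong (yes p) u≡v = cong (1ℚ *_) (u≡v p)
⟦⟧-*-cong (no _) {u} {v} _ = trans (*-zeroˡ u) (sym (*-zeroˡ v))

⟦⟧-split : (P? : Dec P) (v : ℚ) → v ≡ ⟦ P? ⟧ * v + ⟦ ¬? P? ⟧ * v
⟦⟧-split P? v = begin
  v                              ≡⟨ *-identityˡ v ⟨
  1ℚ * v                         ≡⟨ cong (_* v) (complement P?) ⟨
  (⟦ P? ⟧ + ⟦ ¬? P? ⟧) * v       ≡⟨ *-distribʳ-+ v ⟦ P? ⟧ ⟦ ¬? P? ⟧ ⟩
  ⟦ P? ⟧ * v + ⟦ ¬? P? ⟧ * v     ∎
  where
  complement : (P? : Dec P) → ⟦ P? ⟧ + ⟦ ¬? P? ⟧ ≡ 1ℚ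
  complement (yes _) = refl
  complement (no _)  = refl

⟦⟧-⊎ : (P? : Dec P) (Q? : Dec Q) → ¬ (P × Q) → ⟦ P? ⊎-dec Q? ⟧ ≡ ⟦ P? ⟧ + ⟦ Q? ⟧
⟦⟧-⊎ (yes p) (yes q) ¬pq = contradiction (p , q) ¬pq
⟦⟧-⊎ (yes _) (no _)  _   = refl
⟦⟧-⊎ (no _)  (yes _) _   = refl
⟦⟧-⊎ (no _)  (no _)  _   = refl

∑-single : ∀ {f : Fin n → ℚ} a → (∀ x → x ≢ a → f x ≡ 0ℚ) → ∑[ x < n ] f x ≡ f a
∑-single {suc n} {f} a off = begin
  sum f                                ≡⟨ sum-remove f ⟩
  f a + sum (f ∘ punchIn a)            ≡⟨ cong (f a +_) (sum-cong-≗ (λ j → off _ (Fin.punchInᵢ≢i a j))) ⟩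
  f a + sum {n} (λ _ → 0ℚ)             ≡⟨ cong (f a +_) (sum-replicate-zero n) ⟩
  f a + 0ℚ                             ≡⟨ +-identityʳ _ ⟩
  f a                                  ∎

∈-insert⇔ : ∀ {x a : Fin n} {B} → x ∈ ⁅ a ⁆ ∪ B ⇔ (x ≡ a ⊎ x ∈ B)
∈-insert⇔ {a = a} {B} =
  mk⇔ (map₁ (x∈⁅y⁆⇒x≡y a) ∘ x∈p∪q⁻ ⁅ a ⁆ B) (x∈p∪q⁺ ∘ map₁ λ { refl → x∈⁅x⁆ a })

Σ∈ : Subset n → (Fin n → ℚ) → ℚ
Σ∈ {n} D f = ∑[ x < n ] (⟦ x ∈? D ⟧ * f x)

Σ∈-cong : ∀ D {f g : Fin n → ℚ} → (∀ {x} → x ∈ D → f x ≡ g x) → Σ∈ D f ≡ Σ∈ D g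
Σ∈-cong D f≡g = sum-cong-≗ (λ x → ⟦⟧-*-cong (x ∈? D) f≡g)

Σ∈-cancel : ∀ D {f g : Fin n → ℚ} → (∀ {x} → x ∉ D → f x ≡ g x) →
            ∑[ x < n ] f x ≡ ∑[ x < n ] g x → Σ∈ D f ≡ Σ∈ D g
Σ∈-cancel {n} D {f} {g} f≡g ∑f≡∑g = ∙-cancelʳ (Σ∉ g) (Σ∈ D f) (Σ∈ D g) (begin
  Σ∈ D f + Σ∉ g  ≡⟨ cong (Σ∈ D f +_) (sum-cong-≗ (λ x → ⟦⟧-*-cong (¬? (x ∈? D)) f≡g)) ⟨
  Σ∈ D f + Σ∉ f  ≡⟨ split f ⟨
  sum f          ≡⟨ ∑f≡∑g ⟩
  sum g          ≡⟨ split g ⟩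
  Σ∈ D g + Σ∉ g  ∎)
  where
  Σ∉ : (Fin n → ℚ) → ℚ
  Σ∉ h = ∑[ x < n ] (⟦ ¬? (x ∈? D) ⟧ * h x)
  split : ∀ h → sum h ≡ Σ∈ D h + Σ∉ h
  split h = trans (sum-cong-≗ (λ x → ⟦⟧-split (x ∈? D) (h x)))
                  (∑-distrib-+ (λ x → ⟦ x ∈? D ⟧ * h x) (λ x → ⟦ ¬? (x ∈? D) ⟧ * h x))

Σ∈-insert : ∀ {a : Fin n} {B} (f : Fin n → ℚ) → a ∉ B → Σ∈ (⁅ a ⁆ ∪ B) f ≡ f a + Σ∈ B f
Σ∈-insert {n} {a} {B} f a∉B = begin
  Σ∈ (⁅ a ⁆ ∪ B) f                                   ≡⟨ sum-cong-≗ split ⟩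
  ∑[ x < n ] (⟦ x ≟ a ⟧ * f x + ⟦ x ∈? B ⟧ * f x)    ≡⟨ ∑-distrib-+ (λ x → ⟦ x ≟ a ⟧ * f x) _ ⟩
  ∑[ x < n ] (⟦ x ≟ a ⟧ * f x) + Σ∈ B f              ≡⟨ cong (_+ Σ∈ B f) (∑-single a off-a) ⟩
  ⟦ a ≟ a ⟧ * f a + Σ∈ B f                           ≡⟨ cong (λ c → c * f a + Σ∈ B f) (⟦⟧-yes (a ≟ a) refl) ⟩
  1ℚ * f a + Σ∈ B f                                  ≡⟨ cong (_+ Σ∈ B f) (*-identityˡ (f a)) ⟩
  f a + Σ∈ B f                                       ∎
  where
  split : ∀ x → ⟦ x ∈? ⁅ a ⁆ ∪ B ⟧ * f x ≡ ⟦ x ≟ a ⟧ * f x + ⟦ x ∈? B ⟧ * f x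
  split x = begin
    ⟦ x ∈? ⁅ a ⁆ ∪ B ⟧ * f x
      ≡⟨ cong (_* f x) (⟦⟧-⇔ ∈-insert⇔ (x ∈? ⁅ a ⁆ ∪ B) ((x ≟ a) ⊎-dec (x ∈? B))) ⟩
    ⟦ (x ≟ a) ⊎-dec (x ∈? B) ⟧ * f x
      ≡⟨ cong (_* f x) (⟦⟧-⊎ (x ≟ a) (x ∈? B) λ { (refl , a∈B) → a∉B a∈B }) ⟩
    (⟦ x ≟ a ⟧ + ⟦ x ∈? B ⟧) * f x
      ≡⟨ *-distribʳ-+ (f x) ⟦ x ≟ a ⟧ ⟦ x ∈? B ⟧ ⟩
    ⟦ x ≟ a ⟧ * f x + ⟦ x ∈? B ⟧ * f x
      ∎
  off-a : ∀ x → x ≢ a → ⟦ x ≟ a ⟧ * f x ≡ 0ℚ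
  off-a x x≢a = trans (cong (_* f x) (⟦⟧-no (x ≟ a) x≢a)) (*-zeroˡ (f x))

-- Möbius inversion over subsets

ΣS : (Subset n → ℚ) → ℚ
ΣS {zero}  h = h []
ΣS {suc n} h = ΣS (h ∘ (inside ∷_)) + ΣS (h ∘ (outside ∷_))

ΣS-cong : ∀ {f g : Subset n → ℚ} → (∀ T → f T ≡ g T) → ΣS f ≡ ΣS g
ΣS-cong {zero}  f≡g = f≡g []
ΣS-cong {suc n} f≡g = cong₂ _+_ (ΣS-cong (f≡g ∘ (inside ∷_))) (ΣS-cong (f≡g ∘ (outside ∷_)))

ΣS-zero : ∀ {f : Subset n → ℚ} → (∀ T → f T ≡ 0ℚ) → ΣS f ≡ 0ℚ
ΣS-zero {zero}  f≡0 = f≡0 []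
ΣS-zero {suc n} f≡0 = cong₂ _+_ (ΣS-zero (f≡0 ∘ (inside ∷_))) (ΣS-zero (f≡0 ∘ (outside ∷_)))

ΣS-distrib-+ : ∀ (f g : Subset n → ℚ) → ΣS (λ T → f T + g T) ≡ ΣS f + ΣS g
ΣS-distrib-+ {zero}  f g = refl
ΣS-distrib-+ {suc n} f g =
  trans (cong₂ _+_ (ΣS-distrib-+ (f ∘ (inside ∷_)) (g ∘ (inside ∷_)))
                   (ΣS-distrib-+ (f ∘ (outside ∷_)) (g ∘ (outside ∷_))))
        (interchange (ΣS (f ∘ (inside ∷_))) (ΣS (g ∘ (inside ∷_)))
                     (ΣS (f ∘ (outside ∷_))) (ΣS (g ∘ (outside ∷_))))

ΣS-single : ∀ {f : Subset n → ℚ} P → (∀ T → T ≢ P → f T ≡ 0ℚ) → ΣS f ≡ f P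
ΣS-single []            _   = refl
ΣS-single (inside ∷ P)  off =
  trans (cong₂ _+_ (ΣS-single P λ T T≢P → off (inside ∷ T) (T≢P ∘ ∷-injectiveʳ))
                   (ΣS-zero λ T → off (outside ∷ T) λ ()))
        (+-identityʳ _)
ΣS-single (outside ∷ P) off =
  trans (cong₂ _+_ (ΣS-zero λ T → off (inside ∷ T) λ ())
                   (ΣS-single P λ T T≢P → off (outside ∷ T) (T≢P ∘ ∷-injectiveʳ)))
        (+-identityˡ _)

∑-ΣS-comm : ∀ {m} (F : Fin m → Subset n → ℚ) → ∑[ a < m ] ΣS (F a) ≡ ΣS (λ T → ∑[ a < m ] F a T)
∑-ΣS-comm {n} {m = zero} F = sym (ΣS-zero {n} λ _ → refl)
∑-ΣS-comm {m = suc m} F =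
  trans (cong (ΣS (F zero) +_) (∑-ΣS-comm (F ∘ suc))) (sym (ΣS-distrib-+ (F zero) _))

μ : (Subset n → ℚ) → Subset n → ℚ
μ {zero}  f []            = f []
μ {suc n} f (inside ∷ T)  = μ (λ T′ → f (inside ∷ T′) - f (outside ∷ T′)) T
μ {suc n} f (outside ∷ T) = μ (f ∘ (outside ∷_)) T

ζ : (Subset n → ℚ) → Subset n → ℚ
ζ m D = ΣS (λ T → ⟦ T ⊆? D ⟧ * m T)

ζ∘μ : ∀ (f : Subset n → ℚ) D → ζ (μ f) D ≡ f D
ζ∘μ {zero}  f []            = *-identityˡ (f [])
ζ∘μ {suc n} f (inside ∷ D)  =
  trans (cong₂ _+_ (ζ∘μ _ D) (ζ∘μ _ D)) (//-rightDividesˡ (f (outside ∷ D)) (f (inside ∷ D)))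
ζ∘μ {suc n} f (outside ∷ D) =
  trans (cong₂ _+_ (ΣS-zero λ T → *-zeroˡ (μ f (inside ∷ T))) (ζ∘μ _ D)) (+-identityˡ (f (outside ∷ D)))

Heads : Fin n → Subset n → Subset n → Set
Heads a B T = a ∈ T × T ⊆ ⁅ a ⁆ ∪ B

heads? : ∀ (a : Fin n) B T → Dec (Heads a B T)
heads? a B T = (a ∈? T) ×-dec (T ⊆? ⁅ a ⁆ ∪ B)

ζ-insert : ∀ (m : Subset n → ℚ) {a B} → a ∉ B →
           ζ m (⁅ a ⁆ ∪ B) ≡ ζ m B + ΣS (λ T → ⟦ heads? a B T ⟧ * m T)
ζ-insert m {a} {B} a∉B =
  trans (ΣS-cong λ T → trans (cong (_* m T) (split T)) (*-distribʳ-+ (m T) ⟦ T ⊆? B ⟧ ⟦ heads? a B T ⟧))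
        (ΣS-distrib-+ (λ T → ⟦ T ⊆? B ⟧ * m T) (λ T → ⟦ heads? a B T ⟧ * m T))
  where
  split : ∀ T → ⟦ T ⊆? ⁅ a ⁆ ∪ B ⟧ ≡ ⟦ T ⊆? B ⟧ + ⟦ heads? a B T ⟧
  split T with a ∈? T
  ... | yes a∈T = sym (trans (cong (_+ ⟦ T ⊆? ⁅ a ⁆ ∪ B ⟧) (⟦⟧-no (T ⊆? B) λ T⊆B → a∉B (T⊆B a∈T)))
                             (+-identityˡ ⟦ T ⊆? ⁅ a ⁆ ∪ B ⟧))
  ... | no  a∉T = trans (⟦⟧-⇔ (mk⇔ shrink λ T⊆B → x∈p∪q⁺ ∘ inj₂ ∘ T⊆B) (T ⊆? ⁅ a ⁆ ∪ B) (T ⊆? B))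
                        (sym (+-identityʳ ⟦ T ⊆? B ⟧))
    where
    shrink : T ⊆ ⁅ a ⁆ ∪ B → T ⊆ B
    shrink T⊆ x∈T with Equivalence.to ∈-insert⇔ (T⊆ x∈T)
    ... | inj₁ refl = contradiction x∈T a∉T
    ... | inj₂ x∈B  = x∈B

increment≡Σμ : ∀ (φ : Subset n → ℚ) {a B v} → a ∉ B → φ (⁅ a ⁆ ∪ B) ≡ v + φ B →
               v ≡ ΣS (λ T → ⟦ heads? a B T ⟧ * μ φ T)
increment≡Σμ φ {a} {B} {v} a∉B step = ∙-cancelʳ (φ B) v headSum (begin
  v + φ B                   ≡⟨ step ⟨
  φ (⁅ a ⁆ ∪ B)             ≡⟨ ζ∘μ φ (⁅ a ⁆ ∪ B) ⟨
  ζ (μ φ) (⁅ a ⁆ ∪ B)       ≡⟨ ζ-insert (μ φ) a∉B ⟩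
  ζ (μ φ) B + headSum       ≡⟨ cong (_+ headSum) (ζ∘μ φ B) ⟩
  φ B + headSum             ≡⟨ +-comm (φ B) headSum ⟩
  headSum + φ B             ∎)
  where
  headSum : ℚ
  headSum = ΣS (λ T → ⟦ heads? a B T ⟧ * μ φ T)

-- The score of a DAG

sumℚ-++ : ∀ xs ys → sumℚ (xs ++ ys) ≡ sumℚ xs + sumℚ ys
sumℚ-++ []       ys = sym (+-identityˡ (sumℚ ys))
sumℚ-++ (x ∷ xs) ys = trans (cong (x +_) (sumℚ-++ xs ys)) (sym (+-assoc x (sumℚ xs) (sumℚ ys)))

sumℚ-concatMap : ∀ {A : Set} (f : A → List ℚ) xs → sumℚ (concatMap f xs) ≡ sumℚ (map (sumℚ ∘ f) xs)
sumℚ-concatMap f []       = refl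
sumℚ-concatMap f (x ∷ xs) = trans (sumℚ-++ (f x) (concatMap f xs)) (cong (sumℚ (f x) +_) (sumℚ-concatMap f xs))

sumℚ-tabulate : ∀ (g : Fin n → ℚ) → sumℚ (List.tabulate g) ≡ ∑[ a < n ] g a
sumℚ-tabulate {zero}  g = refl
sumℚ-tabulate {suc n} g = cong (g zero +_) (sumℚ-tabulate (g ∘ suc))

sumℚ-allSubsets : ∀ (h : Subset n → ℚ) → sumℚ (map h (allSubsets n)) ≡ ΣS h
sumℚ-allSubsets {zero}  h = +-identityʳ (h [])
sumℚ-allSubsets {suc n} h = begin
  sumℚ (map h (map (inside ∷_) S ++ map (outside ∷_) S))
    ≡⟨ cong sumℚ (map-++ h (map (inside ∷_) S) (map (outside ∷_) S)) ⟩
  sumℚ (map h (map (inside ∷_) S) ++ map h (map (outside ∷_) S))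
    ≡⟨ sumℚ-++ (map h (map (inside ∷_) S)) _ ⟩
  sumℚ (map h (map (inside ∷_) S)) + sumℚ (map h (map (outside ∷_) S))
    ≡⟨ cong₂ (λ xs ys → sumℚ xs + sumℚ ys) (map-∘ S) (map-∘ S) ⟨
  sumℚ (map (h ∘ (inside ∷_)) S) + sumℚ (map (h ∘ (outside ∷_)) S)
    ≡⟨ cong₂ _+_ (sumℚ-allSubsets (h ∘ (inside ∷_))) (sumℚ-allSubsets (h ∘ (outside ∷_))) ⟩
  ΣS h ∎
  where S = allSubsets n

weight : Point n → Fin n → Subset n → ℚ
weight o a B = ⟦ inΥ? a B ⟧ * o a B

-- The summand of ⟨_,_⟩ is a where-bound function of Defs that cannot be named: the `_` in the
-- type of term≡ is solved from its use in ⟨,⟩-unfold, and term≡ then splits on the same inΥ? a B.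
mutual
  ⟨,⟩-unfold : ∀ {n} (o x : Point n) →
               ⟨ o , x ⟩ ≡ sumℚ (concatMap (λ a → map (λ B → weight o a B * x a B) (allSubsets n)) (allFinL n))
  ⟨,⟩-unfold {n} o x = cong sumℚ (concatMap-cong (λ a → map-cong (term≡ o x a) (allSubsets n)) (allFinL n))

  term≡ : ∀ {n} (o x : Point n) a B → _ ≡ weight o a B * x a B
  term≡ o x a B with inΥ? a B
  ... | yes a|B = sym (begin
    ⟦ inΥ? a B ⟧ * o a B * x a B  ≡⟨ cong (λ c → c * o a B * x a B) (⟦⟧-yes (inΥ? a B) a|B) ⟩
    1ℚ * o a B * x a B            ≡⟨ cong (_* x a B) (*-identityˡ (o a B)) ⟩
    o a B * x a B                 ∎)
  ... | no ¬a|B = sym (begin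
    ⟦ inΥ? a B ⟧ * o a B * x a B  ≡⟨ cong (λ c → c * o a B * x a B) (⟦⟧-no (inΥ? a B) ¬a|B) ⟩
    0ℚ * o a B * x a B            ≡⟨ cong (_* x a B) (*-zeroˡ (o a B)) ⟩
    0ℚ * x a B                    ≡⟨ *-zeroˡ (x a B) ⟩
    0ℚ                            ∎)

η-parents : ∀ (G : DAG n) a → η G a (pa G a) ≡ 1ℚ
η-parents G a with ≡-dec Bool._≟_ (pa G a) (pa G a)
... | yes _  = refl
... | no  ≢p = contradiction refl ≢p

η-nonparents : ∀ (G : DAG n) {a B} → B ≢ pa G a → η G a B ≡ 0ℚ
η-nonparents G {a} {B} B≢pa with ≡-dec Bool._≟_ B (pa G a)
... | yes B≡pa = contradiction B≡pa B≢pa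
... | no  _    = refl

score-η : ∀ (o : Point n) (G : DAG n) → ⟨ o , η G ⟩ ≡ ∑[ a < n ] weight o a (pa G a)
score-η {n} o G = begin
  ⟨ o , η G ⟩                                                        ≡⟨ ⟨,⟩-unfold o (η G) ⟩
  sumℚ (concatMap (λ a → map (term a) (allSubsets n)) (allFinL n))   ≡⟨ sumℚ-concatMap _ (allFinL n) ⟩
  sumℚ (map rowSum (allFinL n))                                      ≡⟨ cong sumℚ (map-tabulate id rowSum) ⟩
  sumℚ (List.tabulate rowSum)                                        ≡⟨ sumℚ-tabulate rowSum ⟩
  ∑[ a < n ] rowSum a                                                ≡⟨ sum-cong-≗ (sumℚ-allSubsets ∘ term) ⟩
  ∑[ a < n ] ΣS (term a)                                             ≡⟨ sum-cong-≗ (λ a → ΣS-single (pa G a) (off a)) ⟩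
  ∑[ a < n ] term a (pa G a)                                         ≡⟨ sum-cong-≗ on ⟩
  ∑[ a < n ] weight o a (pa G a)                                     ∎
  where
  term : Fin n → Subset n → ℚ
  term a B = weight o a B * η G a B
  rowSum : Fin n → ℚ
  rowSum a = sumℚ (map (term a) (allSubsets n))
  off : ∀ a T → T ≢ pa G a → term a T ≡ 0ℚ
  off a T T≢pa = trans (cong (weight o a T *_) (η-nonparents G T≢pa)) (*-zeroʳ (weight o a T))
  on : ∀ a → term a (pa G a) ≡ weight o a (pa G a)
  on a = trans (cong (weight o a (pa G a) *_) (η-parents G a)) (*-identityʳ (weight o a (pa G a)))

-- Full DAGs from level functions

Precedes : (Fin n → ℕ) → Fin n → Fin n → Set
Precedes ℓ y x = ×-Lex _≡_ ℕ._<_ Fin._<_ (ℓ y , y) (ℓ x , x)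

precedes? : ∀ (ℓ : Fin n → ℕ) y x → Dec (Precedes ℓ y x)
precedes? ℓ y x = ×-decidable ℕ._≟_ ℕ._<?_ Fin._<?_ (ℓ y , y) (ℓ x , x)

levelledParents : (Fin n → ℕ) → Fin n → Subset n
levelledParents ℓ x = tabulate (λ y → does (precedes? ℓ y x))

from-does : (P? : Dec P) → does P? ≡ true → P
from-does (yes p) _ = p

∈-levelledParents⁺ : ∀ {ℓ : Fin n → ℕ} {x y} → Precedes ℓ y x → y ∈ levelledParents ℓ x
∈-levelledParents⁺ {ℓ = ℓ} {x} {y} y≺x =
  lookup⇒[]= y _ (trans (lookup∘tabulate _ y) (dec-true (precedes? ℓ y x) y≺x))

∈-levelledParents⁻ : ∀ {ℓ : Fin n → ℕ} {x y} → y ∈ levelledParents ℓ x → Precedes ℓ y x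
∈-levelledParents⁻ {ℓ = ℓ} {x} {y} y∈ =
  from-does (precedes? ℓ y x) (trans (sym (lookup∘tabulate _ y)) ([]=⇒lookup y∈))

lexOrder : IsStrictTotalOrder (Pointwise _≡_ _≡_) (×-Lex _≡_ ℕ._<_ (Fin._<_ {n}))
lexOrder = ×-isStrictTotalOrder ℕ.<-isStrictTotalOrder Fin.<-isStrictTotalOrder

levelled : (Fin n → ℕ) → DAG n
levelled ℓ = record
  { pa      = levelledParents ℓ
  ; acyclic = λ x cycle → IsStrictTotalOrder.irrefl lexOrder (refl , refl) (ascending cycle)
  }
  where
  ascending : ∀ {y x} → TransClosure (Arrow (levelledParents ℓ)) y x → Precedes ℓ y x
  ascending [ y→x ]       = ∈-levelledParents⁻ y→x
  ascending (y→z ∷ z→⁺x)  = IsStrictTotalOrder.trans lexOrder (∈-levelledParents⁻ y→z) (ascending z→⁺x)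

levelled-full : ∀ (ℓ : Fin n → ℕ) → Full (levelled ℓ)
levelled-full ℓ x y x≢y with IsStrictTotalOrder.compare lexOrder (ℓ x , x) (ℓ y , y)
... | tri< x≺y _ _        = inj₁ (∈-levelledParents⁺ x≺y)
... | tri≈ _ (_ , x≡y) _  = contradiction x≡y x≢y
... | tri> _ _ y≺x        = inj₂ (∈-levelledParents⁺ y≺x)

precedes-at : ∀ (ℓ : Fin n → ℕ) y {x k} → ℓ x ≡ k →
              does (precedes? ℓ y x) ≡ (ℓ y <ᵇ k) ∨ (ℓ y ≡ᵇ k) ∧ does (y Fin.<? x)
precedes-at ℓ y refl = refl

levelledParents-cong : ∀ {ℓ ℓ′ : Fin n → ℕ} {x k} → ℓ x ≡ k → ℓ′ x ≡ k →
                       (∀ y → (ℓ y <ᵇ k) ≡ (ℓ′ y <ᵇ k)) → (∀ y → (ℓ y ≡ᵇ k) ≡ (ℓ′ y ≡ᵇ k)) →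
                       levelledParents ℓ x ≡ levelledParents ℓ′ x
levelledParents-cong {ℓ = ℓ} {ℓ′} {x} {k} ℓx≡k ℓ′x≡k below level = tabulate-cong λ y → begin
  does (precedes? ℓ y x)                         ≡⟨ precedes-at ℓ y ℓx≡k ⟩
  (ℓ y <ᵇ k) ∨ (ℓ y ≡ᵇ k) ∧ does (y Fin.<? x)     ≡⟨ cong₂ (λ p q → p ∨ q ∧ does (y Fin.<? x)) (below y) (level y) ⟩
  (ℓ′ y <ᵇ k) ∨ (ℓ′ y ≡ᵇ k) ∧ does (y Fin.<? x)   ≡⟨ precedes-at ℓ′ y ℓ′x≡k ⟨
  does (precedes? ℓ′ y x)                         ∎

-- The rest sits on level 2 under both, so that it has the same parents for D = ⁅ a ⁆ ∪ B.
prefixLevel : Subset n → Fin n → ℕ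
prefixLevel D y = if does (y ∈? D) then 0 else 2

insertionLevel : Subset n → Fin n → Fin n → ℕ
insertionLevel B a y = if does (y ∈? B) then 0 else if does (y ≟ a) then 1 else 2

tabulate-∈? : ∀ (B : Subset n) → tabulate (λ y → does (y ∈? B)) ≡ B
tabulate-∈? []            = refl
tabulate-∈? (inside ∷ B)  = cong (inside ∷_) (tabulate-∈? B)
tabulate-∈? (outside ∷ B) = cong (outside ∷_) (tabulate-∈? B)

insertion-parents-of-B : ∀ {B : Subset n} {a x} → x ∈ B →
                         levelledParents (insertionLevel B a) x ≡ levelledParents (prefixLevel B) x
insertion-parents-of-B {B = B} {a} {x} x∈B =
  levelledParents-cong {ℓ = insertionLevel B a} {prefixLevel B} {x}
  (cong (λ b → if b then 0 else if does (x ≟ a) then 1 else 2) x-in-B)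
  (cong (λ b → if b then 0 else 2) x-in-B)
  (λ _ → refl)
  (λ y → levels (does (y ∈? B)) (does (y ≟ a)))
  where
  x-in-B : does (x ∈? B) ≡ true
  x-in-B = dec-true (x ∈? B) x∈B
  levels : ∀ b c → ((if b then 0 else if c then 1 else 2) ≡ᵇ 0) ≡ ((if b then 0 else 2) ≡ᵇ 0)
  levels true  _     = refl
  levels false true  = refl
  levels false false = refl

insertion-parents-outside : ∀ {B : Subset n} {a x} → x ∉ ⁅ a ⁆ ∪ B →
                            levelledParents (insertionLevel B a) x ≡ levelledParents (prefixLevel (⁅ a ⁆ ∪ B)) x
insertion-parents-outside {B = B} {a} {x} x∉ =
  levelledParents-cong {ℓ = insertionLevel B a} {prefixLevel (⁅ a ⁆ ∪ B)} {x}
  (cong₂ (λ b c → if b then 0 else if c then 1 else 2)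
         (dec-false (x ∈? B) (x∉ ∘ x∈p∪q⁺ ∘ inj₂))
         (dec-false (x ≟ a) λ { refl → x∉ (x∈p∪q⁺ (inj₁ (x∈⁅x⁆ a))) }))
  (cong (λ b → if b then 0 else 2) (dec-false (x ∈? ⁅ a ⁆ ∪ B) x∉))
  (λ y → agree y (_<ᵇ 2) refl)
  (λ y → agree y (_≡ᵇ 2) refl)
  where
  -- The two level functions differ only at a, placed on level 1 and on level 0 respectively.
  agree : ∀ y (obs : ℕ → Bool) → obs 1 ≡ obs 0 →
          obs (insertionLevel B a y) ≡ obs (prefixLevel (⁅ a ⁆ ∪ B) y)
  agree y obs obs₁≡obs₀ =
    trans (levels (does (y ∈? B)) (does (y ≟ a)))
          (cong (λ b → obs (if b then 0 else 2))
                (sym (does-⇔ ∈-insert⇔ (y ∈? ⁅ a ⁆ ∪ B) ((y ≟ a) ⊎-dec (y ∈? B)))))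
    where
    levels : ∀ b c → obs (if b then 0 else if c then 1 else 2) ≡ obs (if c ∨ b then 0 else 2)
    levels true  true  = refl
    levels true  false = refl
    levels false true  = obs₁≡obs₀
    levels false false = refl

insertion-parents-of-a : ∀ {B : Subset n} {a} → a ∉ B → levelledParents (insertionLevel B a) a ≡ B
insertion-parents-of-a {B = B} {a} a∉B = trans (tabulate-cong below-a) (tabulate-∈? B)
  where
  level-a : insertionLevel B a a ≡ 1
  level-a = cong₂ (λ b c → if b then 0 else if c then 1 else 2)
                  (dec-false (a ∈? B) a∉B) (dec-true (a ≟ a) refl)
  below-a : ∀ y → does (precedes? (insertionLevel B a) y a) ≡ does (y ∈? B)
  below-a y = trans (precedes-at (insertionLevel B a) y {a} level-a) (from-levels (y ∈? B) (y ≟ a))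
    where
    from-levels : (y∈?B : Dec (y ∈ B)) (y≟a : Dec (y ≡ a)) →
                  ((if does y∈?B then 0 else if does y≟a then 1 else 2) <ᵇ 1) ∨
                  ((if does y∈?B then 0 else if does y≟a then 1 else 2) ≡ᵇ 1) ∧ does (y Fin.<? a)
                  ≡ does y∈?B
    from-levels (yes _) _          = refl
    from-levels (no _)  (no _)     = refl
    from-levels (no _)  (yes refl) = dec-false (a Fin.<? a) (Fin.<-irrefl refl)

-- The potential of an objective that is constant on full DAGs

potential : (Fin n → Subset n → ℚ) → Subset n → ℚ
potential w D = Σ∈ D (λ x → w x (levelledParents (prefixLevel D) x))

potential-insert : ∀ (w : Fin n → Subset n → ℚ) {u} →
                   (∀ ℓ → ∑[ x < n ] w x (levelledParents ℓ x) ≡ u) →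
                   ∀ {a B} → a ∉ B → potential w (⁅ a ⁆ ∪ B) ≡ w a B + potential w B
potential-insert {n} w levelled-constant {a} {B} a∉B = begin
  Σ∈ D (score (prefixLevel D))
    ≡⟨ Σ∈-cancel D (λ x∉D → cong (w _) (sym (insertion-parents-outside x∉D)))
                   (trans (levelled-constant (prefixLevel D)) (sym (levelled-constant (insertionLevel B a)))) ⟩
  Σ∈ D (score (insertionLevel B a))
    ≡⟨ Σ∈-insert (score (insertionLevel B a)) a∉B ⟩
  score (insertionLevel B a) a + Σ∈ B (score (insertionLevel B a))
    ≡⟨ cong₂ _+_ (cong (w a) (insertion-parents-of-a a∉B))
                 (Σ∈-cong B λ x∈B → cong (w _) (insertion-parents-of-B x∈B)) ⟩
  w a B + potential w B ∎
  where
  D : Subset n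
  D = ⁅ a ⁆ ∪ B
  score : (Fin n → ℕ) → Fin n → ℚ
  score ℓ x = w x (levelledParents ℓ x)

-- The characteristic imset

charImset : DAG n → Subset n → ℚ
charImset G T = ⟦ Fin.any? (λ a → heads? a (pa G a) T) ⟧

a∉pa : ∀ (G : DAG n) a → a ∉ pa G a
a∉pa G a a∈pa = acyclic G a [ a∈pa ]

heads-unique : ∀ (G : DAG n) {a b T} → Heads a (pa G a) T → Heads b (pa G b) T → a ≡ b
heads-unique G {a} {b} (a∈T , T⊆a) (b∈T , T⊆b)
  with Equivalence.to ∈-insert⇔ (T⊆a b∈T) | Equivalence.to ∈-insert⇔ (T⊆b a∈T)
... | inj₁ b≡a  | _          = sym b≡a
... | inj₂ _    | inj₁ a≡b   = a≡b
... | inj₂ b→a  | inj₂ a→b   = contradiction (a→b ∷ [ b→a ]) (acyclic G a)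

∑-heads≡charImset : ∀ (G : DAG n) T → ∑[ a < n ] ⟦ heads? a (pa G a) T ⟧ ≡ charImset G T
∑-heads≡charImset {n} G T with Fin.any? (λ a → heads? a (pa G a) T)
... | yes (a , a-heads) =
  trans (∑-single a λ x x≢a → ⟦⟧-no (heads? x (pa G x) T) (x≢a ∘ sym ∘ heads-unique G a-heads))
        (⟦⟧-yes (heads? a (pa G a) T) a-heads)
... | no  no-head =
  trans (sum-cong-≗ λ x → ⟦⟧-no (heads? x (pa G x) T) (no-head ∘ (x ,_))) (sum-replicate-zero n)

score-charImset : ∀ (w : Fin n → Subset n → ℚ) (m : Subset n → ℚ) →
                  (∀ {a B} → a ∉ B → w a B ≡ ΣS (λ T → ⟦ heads? a B T ⟧ * m T)) →
                  ∀ G → ∑[ a < n ] w a (pa G a) ≡ ΣS (λ T → charImset G T * m T)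
score-charImset {n} w m w-mobius G = begin
  ∑[ a < n ] w a (pa G a)
    ≡⟨ sum-cong-≗ (λ a → w-mobius (a∉pa G a)) ⟩
  ∑[ a < n ] ΣS (λ T → ⟦ heads? a (pa G a) T ⟧ * m T)
    ≡⟨ ∑-ΣS-comm (λ a T → ⟦ heads? a (pa G a) T ⟧ * m T) ⟩
  ΣS (λ T → ∑[ a < n ] (⟦ heads? a (pa G a) T ⟧ * m T))
    ≡⟨ ΣS-cong (λ T → *-distribʳ-sum (m T) (λ a → ⟦ heads? a (pa G a) T ⟧)) ⟨
  ΣS (λ T → (∑[ a < n ] ⟦ heads? a (pa G a) T ⟧) * m T)
    ≡⟨ ΣS-cong (λ T → cong (_* m T) (∑-heads≡charImset G T)) ⟩
  ΣS (λ T → charImset G T * m T)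
    ∎

descendants-wellFounded : ∀ (G : DAG n) → WellFounded (flip (TransClosure (Arrow (pa G))))
descendants-wellFounded G = spo-wellFounded (Flip.isStrictPartialOrder ancestors)
  where
  ancestors : IsStrictPartialOrder _≡_ (TransClosure (Arrow (pa G)))
  ancestors = record
    { isEquivalence = isEquivalence
    ; irrefl        = λ { refl → acyclic G _ }
    ; trans         = transitive (Arrow (pa G))
    ; <-resp-≈      = (λ { refl r → r }) , (λ { refl r → r })
    }

IsSink : DAG n → Subset n → Fin n → Set
IsSink G T d = d ∈ T × (∀ {x} → x ∈ T → d ∉ pa G x)

sink : ∀ (G : DAG n) {T t} → t ∈ T → ∃ (IsSink G T)
sink G {T} t∈T = descend t∈T (descendants-wellFounded G _)
  where
  descend : ∀ {d} → d ∈ T → Acc (flip (TransClosure (Arrow (pa G)))) d → ∃ (IsSink G T)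
  descend {d} d∈T (acc rec) with Fin.any? (λ x → (x ∈? T) ×-dec (d ∈? pa G x))
  ... | yes (x , x∈T , d→x) = descend x∈T (rec [ d→x ])
  ... | no  no-child        = d , d∈T , λ x∈T d→x → no-child (_ , x∈T , d→x)

∼-sym : ∀ {G H : DAG n} → G ∼ H → H ∼ G
∼-sym (sameAdj , sameImm) = (λ a b → ⇔.sym (sameAdj a b)) , (λ a b c → ⇔.sym (sameImm a b c))

heads-∼ : ∀ {G H : DAG n} {T} → G ∼ H → ∃ (λ a → Heads a (pa G a) T) → ∃ (λ d → Heads d (pa H d) T)
heads-∼ {G = G} {H} {T} (sameAdj , sameImm) (a , a∈T , T⊆faG) with sink H a∈T
... | d , d∈T , d-sink = d , d∈T , λ x∈T → Equivalence.from ∈-insert⇔ (family x∈T)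
  where
  parentG : ∀ {x} → x ∈ T → x ≢ a → x ∈ pa G a
  parentG x∈T x≢a with Equivalence.to ∈-insert⇔ (T⊆faG x∈T)
  ... | inj₁ x≡a  = contradiction x≡a x≢a
  ... | inj₂ x→a  = x→a
  parentH : ∀ {x} → x ∈ T → Adjacent H x d → x ∈ pa H d
  parentH x∈T (inj₁ x→d) = x→d
  parentH x∈T (inj₂ d→x) = contradiction d→x (d-sink x∈T)
  adjacentG : ∀ {x} → x ∈ T → x ≢ d → Adjacent G x d
  adjacentG {x} x∈T x≢d with x ≟ a | d ≟ a
  ... | yes refl | _        = inj₂ (parentG d∈T (x≢d ∘ sym))
  ... | no  x≢a  | yes refl = inj₁ (parentG x∈T x≢a)
  ... | no  x≢a  | no  d≢a  with (x ∈? pa G d) ⊎-dec (d ∈? pa G x)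
  ...   | yes adjacent = adjacent
  -- Otherwise x → a ← d is an immorality of G, hence of H, and d → a closes a cycle with a → d.
  ...   | no  ¬adjacent = contradiction (a→d ∷ [ d→a ]) (acyclic H a)
    where
    d→a : d ∈ pa H a
    d→a = proj₁ (proj₂ (Equivalence.to (sameImm x d a) (parentG x∈T x≢a , parentG d∈T d≢a , x≢d , ¬adjacent)))
    a→d : a ∈ pa H d
    a→d = parentH a∈T (Equivalence.to (sameAdj a d) (inj₂ (parentG d∈T d≢a)))
  family : ∀ {x} → x ∈ T → x ≡ d ⊎ x ∈ pa H d
  family {x} x∈T with x ≟ d
  ... | yes x≡d = inj₁ x≡d
  ... | no  x≢d = inj₂ (parentH x∈T (Equivalence.to (sameAdj x d) (adjacentG x∈T x≢d)))

charImset-∼ : ∀ {G H : DAG n} → G ∼ H → ∀ T → charImset G T ≡ charImset H T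
charImset-∼ {G = G} {H} G∼H T =
  ⟦⟧-⇔ (mk⇔ (heads-∼ {G = G} {H} G∼H) (heads-∼ {G = H} {G} (∼-sym {G = G} {H} G∼H)))
       (Fin.any? (λ a → heads? a (pa G a) T)) (Fin.any? (λ a → heads? a (pa H a) T))

constant-on-full⇒SE : ∀ (o : Point n) {u} → (∀ H → Full H → ⟨ o , η H ⟩ ≡ u) → SE o
constant-on-full⇒SE {n} o {u} full-constant G H G∼H = begin
  ⟨ o , η G ⟩                      ≡⟨ score-η o G ⟩
  ∑[ a < n ] weight o a (pa G a)   ≡⟨ score-charImset (weight o) m weight-mobius G ⟩
  ΣS (λ T → charImset G T * m T)   ≡⟨ ΣS-cong (λ T → cong (_* m T) (charImset-∼ {G = G} {H} G∼H T)) ⟩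
  ΣS (λ T → charImset H T * m T)   ≡⟨ score-charImset (weight o) m weight-mobius H ⟨
  ∑[ a < n ] weight o a (pa H a)   ≡⟨ score-η o H ⟨
  ⟨ o , η H ⟩                      ∎
  where
  levelled-constant : ∀ ℓ → ∑[ x < n ] weight o x (levelledParents ℓ x) ≡ u
  levelled-constant ℓ = trans (sym (score-η o (levelled ℓ))) (full-constant (levelled ℓ) (levelled-full ℓ))
  m : Subset n → ℚ
  m = μ (potential (weight o))
  weight-mobius : ∀ {a B} → a ∉ B → weight o a B ≡ ΣS (λ T → ⟦ heads? a B T ⟧ * m T)
  weight-mobius a∉B = increment≡Σμ (potential (weight o)) a∉B
                        (potential-insert (weight o) levelled-constant a∉B)

lemma6 : (n : ℕ) → 2 ≤ n → (S : Pred (Point n) 0ℓ) → IsFace S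
       → (∀ (H : DAG n) → Full H → S (η H))
       → IsSEFace S
lemma6 n _ S (o , u , valid , defines) fullInS = o , u , constant-on-full⇒SE o full-constant , valid , defines
  where
  full-constant : ∀ H → Full H → ⟨ o , η H ⟩ ≡ u
  full-constant H full = proj₂ (Equivalence.to (defines (η H)) (fullInS H full))
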